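{- Let $G$ be a graph and let $G^+$ be the graph defined as follows. Take two disjoint copies $G_1$ and $G_2$ of $G$. For each vertex $u \in V(G_1) \cup V(G_2)$ add a new vertex $\pi_u$ and the edge $u\pi_u$. Let $\Pi_1 = \{\pi_u : u \in V(G_1)\}$ and $\Pi_2 = \{\pi_u : u \in V(G_2)\}$, and add all edges between $\Pi_1$ and $\Pi_2$ (so $\Pi_1$ and $\Pi_2$ are each independent and together induce a complete bipartite graph). Then for every integer $s \geqslant 1$, $G^+$ is $\mathbf{E_s}$ if and only if $G$ is $\mathbf{E_{s-1}}$.
   Context: All graphs are finite and simple. For a positive integer $t$, a graph is $t$-extendable if every independent set of size exactly $t$ is contained in a maximum independent set. For $s \geqslant 1$, a graph is $\mathbf{E_s}$ if it is $t$-extendable for every $t \in \{1,\dots,s\}$ (equivalently, every independent set of size at most $s$ is contained in a maximum independent set); by convention every graph is $\mathbf{E_0}$. -}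

module Defs where

open import Data.Nat using (ℕ; _≤_; _*_)
open import Data.Bool using (Bool; true; false)
open import Data.Fin using (Fin; zero; suc; remQuot; _≟_)
open import Data.Fin.Subset using (Subset; _∈_; _⊆_; ∣_∣)
open import Data.Product using (Σ; _×_; _,_; proj₁; proj₂)
open import Relation.Binary.PropositionalEquality using (_≡_)
open import Relation.Nullary using (does)

record Graph : Set where
  field
    n     : ℕ
    adj   : Fin n → Fin n → Bool
    sym   : ∀ u v → adj u v ≡ adj v u
    irref : ∀ u → adj u u ≡ false
open Graph public

Independent : (G : Graph) → Subset (n G) → Set
Independent G S = ∀ u v → u ∈ S → v ∈ S → adj G u v ≡ false

MaximumIndependent : (G : Graph) → Subset (n G) → Set
MaximumIndependent G I =
  Independent G I × (∀ J → Independent G J → ∣ J ∣ ≤ ∣ I ∣)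

Extendable : ℕ → Graph → Set
Extendable t G = ∀ S → Independent G S → ∣ S ∣ ≡ t →
  Σ (Subset (n G)) λ I → MaximumIndependent G I × S ⊆ I

E : ℕ → Graph → Set
E s G = ∀ t → 1 ≤ t → t ≤ s → Extendable t G

-- Vertices are pairs (block , u) with block ∈ Fin 4 and
-- u ∈ Fin n: block 0 = G₁, block 1 = G₂, block 2 = Π₁ (π_u for u ∈ G₁),
-- block 3 = Π₂ (π_u for u ∈ G₂); encoded into Fin (4 * n) via remQuot.

eqb : ∀ {k} → Fin k → Fin k → Bool
eqb u v = does (u ≟ v)

plusAdj : (G : Graph) → Fin 4 × Fin (n G) → Fin 4 × Fin (n G) → Bool
plusAdj G (zero , u) (zero , v) = adj G u v
plusAdj G (suc zero , u) (suc zero , v) = adj G u v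
plusAdj G (zero , u) (suc (suc zero) , v) = eqb u v
plusAdj G (suc (suc zero) , u) (zero , v) = eqb u v
plusAdj G (suc zero , u) (suc (suc (suc zero)) , v) = eqb u v
plusAdj G (suc (suc (suc zero)) , u) (suc zero , v) = eqb u v
plusAdj G (suc (suc zero) , u) (suc (suc (suc zero)) , v) = true
plusAdj G (suc (suc (suc zero)) , u) (suc (suc zero) , v) = true
plusAdj G _ _ = false

private
  eqb-sym : ∀ {k} (u v : Fin k) → eqb u v ≡ eqb v u
  eqb-sym u v with u ≟ v | v ≟ u
  ... | Relation.Nullary.yes _ | Relation.Nullary.yes _ = Relation.Binary.PropositionalEquality.refl
  ... | Relation.Nullary.no _ | Relation.Nullary.no _ = Relation.Binary.PropositionalEquality.refl
  ... | Relation.Nullary.yes p | Relation.Nullary.no q = Data.Empty.⊥-elim (q (Relation.Binary.PropositionalEquality.sym p))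
    where import Data.Empty
  ... | Relation.Nullary.no q | Relation.Nullary.yes p = Data.Empty.⊥-elim (q (Relation.Binary.PropositionalEquality.sym p))
    where import Data.Empty

  open Relation.Binary.PropositionalEquality using (refl)

  plusAdj-sym : ∀ G x y → plusAdj G x y ≡ plusAdj G y x
  plusAdj-sym G (zero , u) (zero , v) = sym G u v
  plusAdj-sym G (zero , u) (suc zero , v) = refl
  plusAdj-sym G (zero , u) (suc (suc zero) , v) = eqb-sym u v
  plusAdj-sym G (zero , u) (suc (suc (suc zero)) , v) = refl
  plusAdj-sym G (suc zero , u) (zero , v) = refl
  plusAdj-sym G (suc zero , u) (suc zero , v) = sym G u v
  plusAdj-sym G (suc zero , u) (suc (suc zero) , v) = refl
  plusAdj-sym G (suc zero , u) (suc (suc (suc zero)) , v) = eqb-sym u v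
  plusAdj-sym G (suc (suc zero) , u) (zero , v) = eqb-sym u v
  plusAdj-sym G (suc (suc zero) , u) (suc zero , v) = refl
  plusAdj-sym G (suc (suc zero) , u) (suc (suc zero) , v) = refl
  plusAdj-sym G (suc (suc zero) , u) (suc (suc (suc zero)) , v) = refl
  plusAdj-sym G (suc (suc (suc zero)) , u) (zero , v) = refl
  plusAdj-sym G (suc (suc (suc zero)) , u) (suc zero , v) = eqb-sym u v
  plusAdj-sym G (suc (suc (suc zero)) , u) (suc (suc zero) , v) = refl
  plusAdj-sym G (suc (suc (suc zero)) , u) (suc (suc (suc zero)) , v) = refl

  plusAdj-irr : ∀ G x → plusAdj G x x ≡ false
  plusAdj-irr G (zero , u) = irref G u
  plusAdj-irr G (suc zero , u) = irref G u
  plusAdj-irr G (suc (suc zero) , u) = refl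
  plusAdj-irr G (suc (suc (suc zero)) , u) = refl

Plus : Graph → Graph
Plus G = record
  { n     = 4 * n G
  ; adj   = λ x y → plusAdj G (remQuot {4} (n G) x) (remQuot {4} (n G) y)
  ; sym   = λ x y → plusAdj-sym G (remQuot {4} (n G) x) (remQuot {4} (n G) y)
  ; irref = λ x → plusAdj-irr G (remQuot {4} (n G) x)
  }

{-# OPTIONS --safe #-}
-- Write an independent set of G⁺ blockwise as (g₁, g₂, π₁, π₂): g₁ and g₂ are independent in G,
-- π_u is taken only when u is not, and π₁ or π₂ is empty. Counting each copy together with its
-- own pendant class gives α(G⁺) = n + α(G), attained by g₁ ∪ K ∪ π(V ∖ g₁) for every independent
-- g₁ and maximum K of G (and symmetrically). So when π₂ = ∅ and the first side is nonempty, S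
-- extends as soon as its part g₂, which has fewer than |S| vertices, extends in G; otherwise the
-- symmetric construction applies. Conversely, a maximum independent set of G⁺ containing T ⊆ V(G₂)
-- and one pendant of Π₁ has π₂ = ∅, and comparing it with J ∪ Π₁ for independent J of G shows that
-- its G₂-part is a maximum independent set of G containing T.
module Submission where

open import Defs hiding (sym)
open import Data.Bool using (true; false)
import Data.Bool.Properties as Bool
open import Data.Fin using (Fin; zero; suc; combine; remQuot; _≟_)
open import Data.Fin.Properties using (all?; combine-remQuot; remQuot-combine)
open import Data.Fin.Subset using (Subset; _∈_; _∉_; _⊆_; ∣_∣; ⊥; ⊤; ∁; ⁅_⁆; Nonempty; Empty)
open import Data.Fin.Subset.Properties
  using (_∈?_; nonempty?; anySubset?; Empty-unique; ∉⊥; ⊥⊆; ∣⊥∣≡0; ∣⊤∣≡n; x∈⁅x⁆; x∈⁅y⁆⇒x≡y; ∣⁅x⁆∣≡1;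
         x∈p⇒x∉∁p; x∉p⇒x∈∁p; ∣∁p∣≡n∸∣p∣; ∣p∣≤n; p⊆q⇒∣p∣≤∣q∣)
open import Data.Nat using (ℕ; zero; suc; _+_; _*_; _∸_; _≤_; _<_; z≤n; s≤s; _≤?_)
open import Data.Nat.Properties
  using (≤-trans; ≤-reflexive; ≤-pred; <⇒≢; <⇒≱; ≮⇒≥; ≰⇒>; n<1⇒n≡0; m≤m+n; m≤n+m; m<m+n; m<n+m;
         +-comm; +-suc; +-identityʳ; +-mono-≤; +-monoʳ-≤; +-cancelˡ-≤; m+[n∸m]≡n; module ≤-Reasoning)
open import Data.Nat.Tactic.RingSolver using (solve-∀)
open import Data.Product using (Σ; ∃; _×_; _,_; proj₁)
open import Data.Sum using (_⊎_; inj₁; inj₂)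
open import Data.Vec using (Vec; []; _∷_; _++_; concat; group; lookup; map; sum)
open import Data.Vec.Properties using (lookup-concat; []=⇒lookup; lookup⇒[]=)
open import Data.Vec.Relation.Binary.Pointwise.Inductive using (Pointwise; []; _∷_)
import Data.Vec.Relation.Binary.Pointwise.Inductive as Pointwise
open import Function using (id)
open import Function.Bundles using (_⇔_; mk⇔)
open import Relation.Binary.PropositionalEquality
  using (_≡_; _≢_; refl; sym; trans; cong; cong₂; subst; subst₂; ≢-sym)
open import Relation.Nullary using (¬_; Dec; yes; no; contradiction)
open import Relation.Nullary.Decidable using (dec-true; dec-false; _×-dec_; _→-dec_)

module _ {m k : ℕ} where

  ∈-concat⁺ : (pss : Vec (Subset k) m) (i : Fin m) {u : Fin k} →
              u ∈ lookup pss i → combine i u ∈ concat pss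
  ∈-concat⁺ pss i {u} u∈ = lookup⇒[]= _ _ (trans (lookup-concat pss i u) ([]=⇒lookup u∈))

  ∈-concat⁻ : (pss : Vec (Subset k) m) (i : Fin m) {u : Fin k} →
              combine i u ∈ concat pss → u ∈ lookup pss i
  ∈-concat⁻ pss i {u} ∈pss = lookup⇒[]= _ _ (trans (sym (lookup-concat pss i u)) ([]=⇒lookup ∈pss))

  ∈-concat-elim : (pss : Vec (Subset k) m) (P : Fin (m * k) → Set) →
                  (∀ i {u} → u ∈ lookup pss i → P (combine i u)) →
                  ∀ {x} → x ∈ concat pss → P x
  ∈-concat-elim pss P f {x} x∈ =
    subst P x≡ (f i (∈-concat⁻ pss i (subst (_∈ concat pss) (sym x≡) x∈)))
    where
    i = proj₁ (remQuot {m} k x)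
    x≡ = combine-remQuot {m} k x

  concat-⊆⁺ : {pss qss : Vec (Subset k) m} → Pointwise _⊆_ pss qss → concat pss ⊆ concat qss
  concat-⊆⁺ {pss} {qss} ps⊆qs =
    ∈-concat-elim pss (_∈ concat qss) λ i u∈ → ∈-concat⁺ qss i (Pointwise.lookup ps⊆qs i u∈)

  concat-⊆⁻ : {pss qss : Vec (Subset k) m} → concat pss ⊆ concat qss →
              ∀ i → lookup pss i ⊆ lookup qss i
  concat-⊆⁻ {pss} {qss} ps⊆qs i u∈ = ∈-concat⁻ qss i (ps⊆qs (∈-concat⁺ pss i u∈))

∣p++q∣ : ∀ {k l} (p : Subset k) (q : Subset l) → ∣ p ++ q ∣ ≡ ∣ p ∣ + ∣ q ∣
∣p++q∣ []          q = refl
∣p++q∣ (true ∷ p)  q = cong suc (∣p++q∣ p q)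
∣p++q∣ (false ∷ p) q = ∣p++q∣ p q

∣concat∣ : ∀ {m k} (pss : Vec (Subset k) m) → ∣ concat pss ∣ ≡ sum (map ∣_∣ pss)
∣concat∣ []        = refl
∣concat∣ (p ∷ pss) = trans (∣p++q∣ p (concat pss)) (cong (∣ p ∣ +_) (∣concat∣ pss))

x∈p⇒0<∣p∣ : ∀ {k} {p : Subset k} {x} → x ∈ p → 0 < ∣ p ∣
x∈p⇒0<∣p∣ {x = x} x∈p =
  subst (_≤ _) (∣⁅x⁆∣≡1 x) (p⊆q⇒∣p∣≤∣q∣ λ y∈⁅x⁆ → subst (_∈ _) (sym (x∈⁅y⁆⇒x≡y x y∈⁅x⁆)) x∈p)

Empty⇒∣p∣≡0 : ∀ {k} {p : Subset k} → Empty p → ∣ p ∣ ≡ 0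
Empty⇒∣p∣≡0 {k} p-empty = trans (cong ∣_∣ (Empty-unique p-empty)) (∣⊥∣≡0 k)

∣p∣+∣⊥∣≡∣p∣ : ∀ {k} (p : Subset k) → ∣ p ∣ + ∣ ⊥ {n = k} ∣ ≡ ∣ p ∣
∣p∣+∣⊥∣≡∣p∣ {k} p = trans (cong (∣ p ∣ +_) (∣⊥∣≡0 k)) (+-identityʳ ∣ p ∣)

Empty⇒∣p∣+∣q∣≡∣p∣ : ∀ {k} {p q : Subset k} → Empty q → ∣ p ∣ + ∣ q ∣ ≡ ∣ p ∣
Empty⇒∣p∣+∣q∣≡∣p∣ {p = p} q-empty =
  trans (cong (λ q → ∣ p ∣ + ∣ q ∣) (Empty-unique q-empty)) (∣p∣+∣⊥∣≡∣p∣ p)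

∣p∣+∣∁p∣≡n : ∀ {k} (p : Subset k) → ∣ p ∣ + ∣ ∁ p ∣ ≡ k
∣p∣+∣∁p∣≡n p = trans (cong (∣ p ∣ +_) (∣∁p∣≡n∸∣p∣ p)) (m+[n∸m]≡n (∣p∣≤n p))

⊆∁⇒∣p∣+∣q∣≤n : ∀ {k} {p q : Subset k} → q ⊆ ∁ p → ∣ p ∣ + ∣ q ∣ ≤ k
⊆∁⇒∣p∣+∣q∣≤n {p = p} {q} q⊆∁p =
  subst (∣ p ∣ + ∣ q ∣ ≤_) (∣p∣+∣∁p∣≡n p) (+-monoʳ-≤ ∣ p ∣ (p⊆q⇒∣p∣≤∣q∣ q⊆∁p))

x∈p⇒y∈∁p⇒x≢y : ∀ {k} {p : Subset k} {u v} → u ∈ p → v ∈ ∁ p → u ≢ v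
x∈p⇒y∈∁p⇒x≢y u∈p v∈∁p refl = x∈p⇒x∉∁p u∈p v∈∁p

last-satisfying : {P : ℕ → Set} → (∀ k → Dec (P k)) →
                  ∀ d {k} → P k → ¬ P (k + d) → ∃ λ m → P m × ¬ P (suc m)
last-satisfying {P} P? zero {k} Pk ¬Pk+0 = contradiction (subst P (sym (+-identityʳ k)) Pk) ¬Pk+0
last-satisfying {P} P? (suc d) {k} Pk ¬Pk+d with P? (suc k)
... | no ¬Pk+1 = k , Pk , ¬Pk+1
... | yes Pk+1 = last-satisfying P? d Pk+1 (subst (λ j → ¬ P j) (+-suc k d) ¬Pk+d)

pattern G₁ = zero
pattern G₂ = suc zero
pattern Π₁ = suc (suc zero)
pattern Π₂ = suc (suc (suc zero))

quad : ∀ {k} → Subset k → Subset k → Subset k → Subset k → Subset (4 * k)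
quad g₁ g₂ π₁ π₂ = concat (g₁ ∷ g₂ ∷ π₁ ∷ π₂ ∷ [])

∣quad∣ : ∀ {k} (g₁ g₂ π₁ π₂ : Subset k) →
         ∣ quad g₁ g₂ π₁ π₂ ∣ ≡ (∣ g₁ ∣ + ∣ π₁ ∣) + (∣ g₂ ∣ + ∣ π₂ ∣)
∣quad∣ g₁ g₂ π₁ π₂ =
  trans (∣concat∣ (g₁ ∷ g₂ ∷ π₁ ∷ π₂ ∷ [])) (regroup (∣ g₁ ∣) (∣ g₂ ∣) (∣ π₁ ∣) (∣ π₂ ∣))
  where
  regroup : ∀ a b c d → a + (b + (c + (d + 0))) ≡ (a + c) + (b + d)
  regroup = solve-∀

record PlusIndependent (G : Graph) (g₁ g₂ π₁ π₂ : Subset (n G)) : Set where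
  field
    independent₁ : Independent G g₁
    independent₂ : Independent G g₂
    π₁⊆∁g₁       : π₁ ⊆ ∁ g₁
    π₂⊆∁g₂       : π₂ ⊆ ∁ g₂
    separated    : ∀ {u v} → u ∈ π₁ → v ∉ π₂

ExtendsToMaximum : (G : Graph) → Subset (n G) → Set
ExtendsToMaximum G S = Σ (Subset (n G)) λ I → MaximumIndependent G I × S ⊆ I

module _ {G : Graph} where

  ⊥-independent : Independent G ⊥
  ⊥-independent _ _ u∈⊥ _ = contradiction u∈⊥ ∉⊥

  independent? : (S : Subset (n G)) → Dec (Independent G S)
  independent? S = all? λ u → all? λ v → (u ∈? S) →-dec ((v ∈? S) →-dec (adj G u v Bool.≟ false))

  maximumIndependent : Σ (Subset (n G)) (MaximumIndependent G)
  maximumIndependent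
    with last-satisfying HasIndependent? (suc (n G)) (⊥ , ⊥-independent , z≤n)
                        (λ (S , _ , n<∣S∣) → <⇒≱ n<∣S∣ (∣p∣≤n S))
    where
    HasIndependent : ℕ → Set
    HasIndependent k = ∃ λ S → Independent G S × k ≤ ∣ S ∣
    HasIndependent? : ∀ k → Dec (HasIndependent k)
    HasIndependent? k = anySubset? λ S → independent? S ×-dec (k ≤? ∣ S ∣)
  ... | _ , (I , I-ind , m≤∣I∣) , ¬Hm+1 =
    I , I-ind , λ J J-ind → ≮⇒≥ λ ∣I∣<∣J∣ → ¬Hm+1 (J , J-ind , ≤-trans (s≤s m≤∣I∣) ∣I∣<∣J∣)

  E⇒extends : ∀ {s T} → E s G → Independent G T → ∣ T ∣ ≤ s → ExtendsToMaximum G T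
  E⇒extends {T = T} hE T-ind ∣T∣≤s with ∣ T ∣ in ∣T∣≡
  ... | zero  = let I , I-max = maximumIndependent in
                I , I-max , λ x∈T → contradiction (subst (0 <_) ∣T∣≡ (x∈p⇒0<∣p∣ x∈T)) λ ()
  ... | suc t = hE (suc t) (s≤s z≤n) ∣T∣≤s T T-ind ∣T∣≡

  adj-Plus-combine : ∀ i u j v →
                     adj (Plus G) (combine i u) (combine j v) ≡ plusAdj G (i , u) (j , v)
  adj-Plus-combine i u j v =
    cong₂ (plusAdj G) (remQuot-combine {4} {n G} i u) (remQuot-combine {4} {n G} j v)

  module _ {g₁ g₂ π₁ π₂ : Subset (n G)} where

    private
      blocks : Vec (Subset (n G)) 4
      blocks = g₁ ∷ g₂ ∷ π₁ ∷ π₂ ∷ []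

    quad-independent⁻ : Independent (Plus G) (quad g₁ g₂ π₁ π₂) → PlusIndependent G g₁ g₂ π₁ π₂
    quad-independent⁻ S-ind = record
      { independent₁ = λ u v → no-edge G₁ G₁
      ; independent₂ = λ u v → no-edge G₂ G₂
      ; π₁⊆∁g₁       = λ {u} u∈π₁ → x∉p⇒x∈∁p λ u∈g₁ → pendant-edge u (no-edge G₁ Π₁ u∈g₁ u∈π₁)
      ; π₂⊆∁g₂       = λ {u} u∈π₂ → x∉p⇒x∈∁p λ u∈g₂ → pendant-edge u (no-edge G₂ Π₂ u∈g₂ u∈π₂)
      ; separated    = λ u∈π₁ v∈π₂ → contradiction (no-edge Π₁ Π₂ u∈π₁ v∈π₂) λ ()
      }
      where
      no-edge : ∀ i j {u v} → u ∈ lookup blocks i → v ∈ lookup blocks j →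
                plusAdj G (i , u) (j , v) ≡ false
      no-edge i j {u} {v} u∈ v∈ =
        trans (sym (adj-Plus-combine i u j v))
              (S-ind _ _ (∈-concat⁺ blocks i u∈) (∈-concat⁺ blocks j v∈))
      pendant-edge : ∀ u → eqb u u ≢ false
      pendant-edge u eq = contradiction (trans (sym (dec-true (u ≟ u) refl)) eq) λ ()

    quad-independent⁺ : PlusIndependent G g₁ g₂ π₁ π₂ → Independent (Plus G) (quad g₁ g₂ π₁ π₂)
    quad-independent⁺ S-ind x y x∈ y∈ =
      ∈-concat-elim blocks (λ x → adj (Plus G) x y ≡ false)
        (λ i {u} u∈ → ∈-concat-elim blocks (λ y → adj (Plus G) (combine i u) y ≡ false)
          (λ j {v} v∈ → trans (adj-Plus-combine i u j v) (no-edge i j u∈ v∈)) y∈) x∈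
      where
      open PlusIndependent S-ind
      no-edge : ∀ i j {u v} → u ∈ lookup blocks i → v ∈ lookup blocks j →
                plusAdj G (i , u) (j , v) ≡ false
      no-edge G₁ G₁ u∈ v∈ = independent₁ _ _ u∈ v∈
      no-edge G₂ G₂ u∈ v∈ = independent₂ _ _ u∈ v∈
      no-edge G₁ Π₁ u∈ v∈ = dec-false (_ ≟ _) (x∈p⇒y∈∁p⇒x≢y u∈ (π₁⊆∁g₁ v∈))
      no-edge Π₁ G₁ u∈ v∈ = dec-false (_ ≟ _) (≢-sym (x∈p⇒y∈∁p⇒x≢y v∈ (π₁⊆∁g₁ u∈)))
      no-edge G₂ Π₂ u∈ v∈ = dec-false (_ ≟ _) (x∈p⇒y∈∁p⇒x≢y u∈ (π₂⊆∁g₂ v∈))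
      no-edge Π₂ G₂ u∈ v∈ = dec-false (_ ≟ _) (≢-sym (x∈p⇒y∈∁p⇒x≢y v∈ (π₂⊆∁g₂ u∈)))
      no-edge Π₁ Π₂ u∈ v∈ = contradiction v∈ (separated u∈)
      no-edge Π₂ Π₁ u∈ v∈ = contradiction u∈ (separated v∈)
      no-edge G₁ G₂ _  _  = refl
      no-edge G₁ Π₂ _  _  = refl
      no-edge G₂ G₁ _  _  = refl
      no-edge G₂ Π₁ _  _  = refl
      no-edge Π₁ G₂ _  _  = refl
      no-edge Π₁ Π₁ _  _  = refl
      no-edge Π₂ G₁ _  _  = refl
      no-edge Π₂ Π₂ _  _  = refl

  ∣quad-⊥⊥∣ : (T π : Subset (n G)) → ∣ quad ⊥ T π ⊥ ∣ ≡ ∣ π ∣ + ∣ T ∣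
  ∣quad-⊥⊥∣ T π = trans (∣quad∣ ⊥ T π ⊥) (cong₂ _+_ (cong (_+ ∣ π ∣) (∣⊥∣≡0 (n G))) (∣p∣+∣⊥∣≡∣p∣ T))

  G₂-plusIndependent : ∀ {T π₁ : Subset (n G)} → Independent G T → PlusIndependent G ⊥ T π₁ ⊥
  G₂-plusIndependent T-ind = record
    { independent₁ = ⊥-independent
    ; independent₂ = T-ind
    ; π₁⊆∁g₁       = λ _ → x∉p⇒x∈∁p ∉⊥
    ; π₂⊆∁g₂       = ⊥⊆
    ; separated    = λ _ → ∉⊥
    }

  ∣side∣≤α : ∀ {g π K : Subset (n G)} → MaximumIndependent G K → Independent G g → Empty π →
             ∣ g ∣ + ∣ π ∣ ≤ ∣ K ∣
  ∣side∣≤α {g} {π} {K} (_ , K-max) g-ind π-empty =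
    subst (_≤ ∣ K ∣) (sym (Empty⇒∣p∣+∣q∣≡∣p∣ {p = g} π-empty)) (K-max g g-ind)

  ∣independent∣≤n+α : ∀ {K : Subset (n G)} {J : Subset (n (Plus G))} →
                      MaximumIndependent G K → Independent (Plus G) J → ∣ J ∣ ≤ n G + ∣ K ∣
  ∣independent∣≤n+α {K} {J} K-max J-ind with group 4 (n G) J
  ... | g₁ ∷ g₂ ∷ π₁ ∷ π₂ ∷ [] , refl
    with quad-independent⁻ {g₁ = g₁} {g₂} {π₁} {π₂} J-ind | nonempty? π₂
  ... | J-ind′ | yes (v , v∈π₂) = subst₂ _≤_ (sym (∣quad∣ g₁ g₂ π₁ π₂)) (+-comm (∣ K ∣) (n G))
        (+-mono-≤ (∣side∣≤α K-max independent₁ λ (u , u∈π₁) → separated u∈π₁ v∈π₂)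
                  (⊆∁⇒∣p∣+∣q∣≤n π₂⊆∁g₂))
    where open PlusIndependent J-ind′
  ... | J-ind′ | no π₂-empty = subst (_≤ n G + ∣ K ∣) (sym (∣quad∣ g₁ g₂ π₁ π₂))
        (+-mono-≤ (⊆∁⇒∣p∣+∣q∣≤n π₁⊆∁g₁) (∣side∣≤α K-max independent₂ π₂-empty))
    where open PlusIndependent J-ind′

  size-n+α⇒maximum : ∀ {K : Subset (n G)} {I : Subset (n (Plus G))} → MaximumIndependent G K →
                    Independent (Plus G) I → ∣ I ∣ ≡ n G + ∣ K ∣ → MaximumIndependent (Plus G) I
  size-n+α⇒maximum K-max I-ind ∣I∣≡ =
    I-ind , λ J J-ind → subst (∣ J ∣ ≤_) (sym ∣I∣≡) (∣independent∣≤n+α K-max J-ind)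

  module _ {g₁ g₂ π₁ π₂ : Subset (n G)} (S-ind : PlusIndependent G g₁ g₂ π₁ π₂) where
    open PlusIndependent S-ind

    extend-through-G₁ : Empty π₁ → ExtendsToMaximum G g₁ →
                        ExtendsToMaximum (Plus G) (quad g₁ g₂ π₁ π₂)
    extend-through-G₁ π₁-empty (K , K-max , g₁⊆K) =
      quad K g₂ ⊥ (∁ g₂) ,
      size-n+α⇒maximum K-max (quad-independent⁺ I-ind) size ,
      concat-⊆⁺ {qss = K ∷ g₂ ∷ ⊥ ∷ ∁ g₂ ∷ []}
        (g₁⊆K ∷ id ∷ (λ u∈π₁ → contradiction (_ , u∈π₁) π₁-empty) ∷ π₂⊆∁g₂ ∷ [])
      where
      I-ind : PlusIndependent G K g₂ ⊥ (∁ g₂)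
      I-ind = record
        { independent₁ = proj₁ K-max ; independent₂ = independent₂
        ; π₁⊆∁g₁ = ⊥⊆ ; π₂⊆∁g₂ = id ; separated = λ u∈⊥ → contradiction u∈⊥ ∉⊥ }
      size : ∣ quad K g₂ ⊥ (∁ g₂) ∣ ≡ n G + ∣ K ∣
      size = trans (∣quad∣ K g₂ ⊥ (∁ g₂))
        (trans (cong₂ _+_ (∣p∣+∣⊥∣≡∣p∣ K) (∣p∣+∣∁p∣≡n g₂)) (+-comm (∣ K ∣) (n G)))

    extend-through-G₂ : Empty π₂ → ExtendsToMaximum G g₂ →
                        ExtendsToMaximum (Plus G) (quad g₁ g₂ π₁ π₂)
    extend-through-G₂ π₂-empty (K , K-max , g₂⊆K) =
      quad g₁ K (∁ g₁) ⊥ ,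
      size-n+α⇒maximum K-max (quad-independent⁺ I-ind) size ,
      concat-⊆⁺ {qss = g₁ ∷ K ∷ ∁ g₁ ∷ ⊥ ∷ []}
        (id ∷ g₂⊆K ∷ π₁⊆∁g₁ ∷ (λ u∈π₂ → contradiction (_ , u∈π₂) π₂-empty) ∷ [])
      where
      I-ind : PlusIndependent G g₁ K (∁ g₁) ⊥
      I-ind = record
        { independent₁ = independent₁ ; independent₂ = proj₁ K-max
        ; π₁⊆∁g₁ = id ; π₂⊆∁g₂ = ⊥⊆ ; separated = λ _ → ∉⊥ }
      size : ∣ quad g₁ K (∁ g₁) ⊥ ∣ ≡ n G + ∣ K ∣
      size = trans (∣quad∣ g₁ K (∁ g₁) ⊥) (cong₂ _+_ (∣p∣+∣∁p∣≡n g₁) (∣p∣+∣⊥∣≡∣p∣ K))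

  pendant-choice : ∀ {g₁ g₂ π₁ π₂ : Subset (n G)} → PlusIndependent G g₁ g₂ π₁ π₂ →
                   0 < (∣ g₁ ∣ + ∣ π₁ ∣) + (∣ g₂ ∣ + ∣ π₂ ∣) →
                   (Empty π₁ × 0 < ∣ g₂ ∣ + ∣ π₂ ∣) ⊎ (Empty π₂ × 0 < ∣ g₁ ∣ + ∣ π₁ ∣)
  pendant-choice {g₁} {g₂} {π₁} {π₂} S-ind 0<∣S∣ with nonempty? π₂ | 1 ≤? ∣ g₁ ∣ + ∣ π₁ ∣
  ... | yes (v , v∈π₂) | _ =
    inj₁ ( (λ (u , u∈π₁) → PlusIndependent.separated S-ind u∈π₁ v∈π₂)
         , ≤-trans (x∈p⇒0<∣p∣ v∈π₂) (m≤n+m _ _))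
  ... | no π₂-empty | yes 0<side₁ = inj₂ (π₂-empty , 0<side₁)
  ... | no _        | no side₁≮1  =
    inj₁ (π₁-empty , subst (λ l → 0 < l + (∣ g₂ ∣ + ∣ π₂ ∣)) side₁≡0 0<∣S∣)
    where
    side₁≡0 : ∣ g₁ ∣ + ∣ π₁ ∣ ≡ 0
    side₁≡0 = n<1⇒n≡0 (≰⇒> side₁≮1)
    π₁-empty : Empty π₁
    π₁-empty (u , u∈π₁) = <⇒≢ (≤-trans (x∈p⇒0<∣p∣ u∈π₁) (m≤n+m _ _)) (sym side₁≡0)

  quad-extends : ∀ {s} {g₁ g₂ π₁ π₂ : Subset (n G)} → E s G → PlusIndependent G g₁ g₂ π₁ π₂ →
                 0 < ∣ quad g₁ g₂ π₁ π₂ ∣ → ∣ quad g₁ g₂ π₁ π₂ ∣ ≤ suc s →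
                 ExtendsToMaximum (Plus G) (quad g₁ g₂ π₁ π₂)
  quad-extends {s} {g₁} {g₂} {π₁} {π₂} hE S-ind 0<∣S∣ ∣S∣≤1+s
    rewrite ∣quad∣ g₁ g₂ π₁ π₂ with pendant-choice S-ind 0<∣S∣
  ... | inj₁ (π₁-empty , 0<side₂) = extend-through-G₁ S-ind π₁-empty
        (E⇒extends hE independent₁
          (≤-trans (m≤m+n _ _) (≤-pred (≤-trans (m<m+n _ 0<side₂) ∣S∣≤1+s))))
    where open PlusIndependent S-ind
  ... | inj₂ (π₂-empty , 0<side₁) = extend-through-G₂ S-ind π₂-empty
        (E⇒extends hE independent₂
          (≤-trans (m≤m+n _ _) (≤-pred (≤-trans (m<n+m _ 0<side₁) ∣S∣≤1+s))))
    where open PlusIndependent S-ind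

  restrict-to-G₂ : ∀ (g₁ g₂ π₁ π₂ : Subset (n G)) → MaximumIndependent (Plus G) (quad g₁ g₂ π₁ π₂) →
                   Nonempty π₁ → MaximumIndependent G g₂
  restrict-to-G₂ g₁ g₂ π₁ π₂ (I-ind , I-max) (u , u∈π₁) =
    independent₂ , λ J J-ind → +-cancelˡ-≤ (n G) _ _ (begin
      n G + ∣ J ∣
        ≡⟨ trans (∣quad-⊥⊥∣ J ⊤) (cong (_+ ∣ J ∣) (∣⊤∣≡n (n G))) ⟨
      ∣ quad ⊥ J ⊤ ⊥ ∣
        ≤⟨ I-max _ (quad-independent⁺ (G₂-plusIndependent {π₁ = ⊤} J-ind)) ⟩
      ∣ quad g₁ g₂ π₁ π₂ ∣
        ≡⟨ ∣quad∣ g₁ g₂ π₁ π₂ ⟩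
      (∣ g₁ ∣ + ∣ π₁ ∣) + (∣ g₂ ∣ + ∣ π₂ ∣)
        ≤⟨ +-mono-≤ (⊆∁⇒∣p∣+∣q∣≤n π₁⊆∁g₁) (≤-reflexive (Empty⇒∣p∣+∣q∣≡∣p∣ {p = g₂} π₂-empty)) ⟩
      n G + ∣ g₂ ∣ ∎)
    where
    open PlusIndependent (quad-independent⁻ {g₁ = g₁} {g₂} {π₁} {π₂} I-ind)
    open ≤-Reasoning
    π₂-empty : Empty π₂
    π₂-empty (v , v∈π₂) = separated u∈π₁ v∈π₂

  Plus-extendable⇒extends : ∀ {t} {T : Subset (n G)} → Extendable (suc t) (Plus G) →
                            Independent G T → ∣ T ∣ ≡ t → Fin (n G) → ExtendsToMaximum G T
  Plus-extendable⇒extends {t} {T} extendable T-ind ∣T∣≡t u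
    with extendable (quad ⊥ T ⁅ u ⁆ ⊥) (quad-independent⁺ (G₂-plusIndependent {π₁ = ⁅ u ⁆} T-ind))
                    (trans (∣quad-⊥⊥∣ T ⁅ u ⁆) (cong₂ _+_ (∣⁅x⁆∣≡1 u) ∣T∣≡t))
  ... | I , I-max , S⊆I with group 4 (n G) I
  ... | g₁ ∷ g₂ ∷ π₁ ∷ π₂ ∷ [] , refl =
    g₂ , restrict-to-G₂ g₁ g₂ π₁ π₂ I-max (u , blockwise Π₁ (x∈⁅x⁆ u)) , blockwise G₂
    where
    blockwise = concat-⊆⁻ {pss = ⊥ ∷ T ∷ ⁅ u ⁆ ∷ ⊥ ∷ []} {qss = g₁ ∷ g₂ ∷ π₁ ∷ π₂ ∷ []} S⊆I

  E-Plus⇒E : ∀ {s} → E (suc s) (Plus G) → E s G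
  E-Plus⇒E hE t 1≤t t≤s T T-ind ∣T∣≡t with nonempty? T
  ... | yes (u , _) = Plus-extendable⇒extends (hE (suc t) (s≤s z≤n) (s≤s t≤s)) T-ind ∣T∣≡t u
  ... | no T-empty  = contradiction (trans (sym ∣T∣≡t) (Empty⇒∣p∣≡0 T-empty)) (≢-sym (<⇒≢ 1≤t))

  E⇒E-Plus : ∀ {s} → E s G → E (suc s) (Plus G)
  E⇒E-Plus {s} hE t 1≤t t≤1+s S S-ind ∣S∣≡t with group 4 (n G) S
  ... | g₁ ∷ g₂ ∷ π₁ ∷ π₂ ∷ [] , refl =
    quad-extends hE (quad-independent⁻ {g₁ = g₁} {g₂} {π₁} {π₂} S-ind)
      (subst (0 <_) (sym ∣S∣≡t) 1≤t) (subst (_≤ suc s) (sym ∣S∣≡t) t≤1+s)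

lemma3 : (G : Graph) (s : ℕ) → 1 ≤ s → (E s (Plus G) ⇔ E (s ∸ 1) G)
lemma3 G (suc s) _ = mk⇔ (E-Plus⇒E {G}) (E⇒E-Plus {G})
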